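{- Let $G=(V,E)$ be a strongly connected digraph that has a good decomposition $C_1,\dots,C_N$ with witness set $F$. Then for every integer $t\ge0$, $y^{\emptyset,t}\in SA^t(P)$, where $P$ is the cone of the balanced polytope of $G$. Moreover, for each $j\in\{1,\dots,N\}$ and each edge $e$ of $C_j$, $y^{\emptyset,t}_{\{e\}}=\frac{t+1}{t+2}$ if $j\in F$ and $y^{\emptyset,t}_{\{e\}}=1$ otherwise.
   Context: Good decomposition: a strongly connected digraph $G=(V,E)$ has a good decomposition with witness set $F$ if $E$ is partitioned into edge-disjoint dicycles $C_1,\dots,C_N$, and $F$ is a nonempty subset of $\{1,\dots,N\}$ such that $G-E(C_j)$ is strongly connected for every $j\in F$. Balanced polytope of $G$: the set of $x\in\mathbb{R}^E$ with $x(\delta^{in}(S))\ge1$, $x(\delta^{out}(S))\ge1$ for all $\emptyset\subsetneq S\subsetneq V$, $x(\delta^{out}(\{v\}))=x(\delta^{in}(\{v\}))$ for all $v\in V$, $0\le x\le1$. Its cone is $\{\lambda(1,x):\lambda\ge0,\ x\text{ in the polytope}\}$. Sherali–Adams for a cone: if $\hat P\subseteq[0,1]^n$ is described by inequalities $\sum_i a_iy_i\ge b$ (including $0\le y_i\le1$, equations as two inequalities) and $P$ is its cone, $SA^t(P)$ is the set of vectors $y=(y_S)$ indexed by subsets $S\subseteq\{1,\dots,n\}$ with $|S|\le t+1$ such that for every inequality and every pair of disjoint $S,Q'$ with $|S|+|Q'|\le t$: $\sum_i a_i\sum_{T\subseteq Q'}(-1)^{|T|}y_{S\cup T\cup\{i\}}\ge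 b\sum_{T\subseteq Q'}(-1)^{|T|}y_{S\cup T}$. The vector $y^{\emptyset,t}$: indexed by all $S\subseteq E$ with $|S|\le t+1$, $y^{\emptyset,t}_S=\frac{t+2-g(S)}{t+2}$, where $g(S)$ is the number of indices $j\in F$ with $E(C_j)\cap S\ne\emptyset$. -}

module Defs where

open import Data.Nat as ℕ using (ℕ; zero; suc; _≤_)
open import Data.Integer as ℤ using (ℤ)
open import Data.Rational as ℚ using (ℚ; 0ℚ; 1ℚ)
open import Data.Bool using (Bool; true; false; if_then_else_; _∧_; not)
open import Data.Fin using (Fin; _≟_)
open import Data.Fin.Subset using (Subset; _∈_; _∉_; _∪_; _∩_; ⁅_⁆; ∣_∣; Nonempty; Empty; ∁; ⊥)
open import Data.Fin.Subset.Properties using (_⊆?_)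
open import Data.List as List using (List; []; _∷_; map; filter; allFin; foldr; _++_)
open import Data.Bool.ListAction using (any)
import Data.List.Membership.Propositional as LM
open import Data.List.Relation.Unary.Linked using (Linked)
open import Data.List.Relation.Unary.Unique.Propositional using (Unique)
open import Data.Vec using (lookup; tabulate)
open import Data.Product using (Σ; _×_; ∃)
open import Relation.Binary.PropositionalEquality using (_≡_; _≢_)
open import Relation.Nullary using (¬_; does)

record Digraph : Set where
  field
    n    : ℕ
    m    : ℕ
    tail : Fin m → Fin n
    head : Fin m → Fin n

module _ (G : Digraph) where
  open Digraph G

  data Reach (A : Fin m → Set) : Fin n → Fin n → Set where
    here : ∀ {u} → Reach A u u
    step : ∀ {v} e → A e → Reach A (head e) v → Reach A (tail e) v

  StronglyConnectedOn : (Fin m → Set) → Set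
  StronglyConnectedOn A = ∀ u v → Reach A u v

  StronglyConnected : Set
  StronglyConnected = StronglyConnectedOn (λ _ → Data.Unit.⊤)
    where import Data.Unit

  -- a dicycle, given as the cyclic list of its edges e₀ e₁ … e_{k-1}
  -- (k ≥ 1): head eᵢ = tail eᵢ₊₁, head e_{k-1} = tail e₀, and the
  -- vertices tail e₀, …, tail e_{k-1} are pairwise distinct.
  lastOf : Fin m → List (Fin m) → Fin m
  lastOf e []       = e
  lastOf e (f ∷ fs) = lastOf f fs

  IsDicycle : List (Fin m) → Set
  IsDicycle []       = Data.Empty.⊥
    where import Data.Empty
  IsDicycle (e ∷ es) =
    Linked (λ f g → head f ≡ tail g) (e ∷ es)
    × head (lastOf e es) ≡ tail e
    × Unique (map tail (e ∷ es))

  record GoodDecomposition : Set where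
    field
      N         : ℕ
      C         : Fin N → List (Fin m)
      dicycle   : ∀ j → IsDicycle (C j)
      partition : ∀ e → Σ (Fin N) λ j → LM._∈_ e (C j) × (∀ j' → LM._∈_ e (C j') → j' ≡ j)
      F         : Subset N
      F-nonempty : Nonempty F
      F-good    : ∀ j → j ∈ F → StronglyConnectedOn (λ e → ¬ LM._∈_ e (C j))

sumℚ : List ℚ → ℚ
sumℚ = foldr ℚ._+_ 0ℚ

sgn : ℕ → ℚ
sgn zero    = 1ℚ
sgn (suc k) = ℚ.- sgn k

subsets : ∀ m → List (Subset m)
subsets zero    = Data.Vec.[] ∷ []
  where import Data.Vec
subsets (suc m) = map (false Data.Vec.∷_) (subsets m) ++ map (true Data.Vec.∷_) (subsets m)
  where import Data.Vec

-- Sherali–Adams of a cone.  A linear inequality Σ a_i y_i ≥ b over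
-- variables indexed by Fin m is given by (a , b).

module _ {m : ℕ} (y : Subset m → ℚ) where

  D : Subset m → Subset m → Subset m → ℚ
  D S Q' R = sumℚ (map (λ T → sgn ∣ T ∣ ℚ.* y (S ∪ T ∪ R)) (filter (_⊆? Q') (subsets m)))

  SAIneq : ℕ → (Fin m → ℚ) → ℚ → Set
  SAIneq t a b = ∀ (S Q' : Subset m) → Empty (S ∩ Q') → ∣ S ∣ ℕ.+ ∣ Q' ∣ ≤ t →
    b ℚ.* D S Q' ⊥ ℚ.≤ sumℚ (map (λ i → a i ℚ.* D S Q' ⁅ i ⁆) (allFin m))

  -- y ∈ SA^t(P) where P̂ is described by the inequalities satisfying Ineq
  InSA : ℕ → ((Fin m → ℚ) → ℚ → Set) → Set
  InSA t Ineq = ∀ a b → Ineq a b → SAIneq t a b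

-- The inequality description of the balanced polytope of G
-- (equations written as two inequalities, bounds 0 ≤ x ≤ 1 included).

module _ (G : Digraph) where
  open Digraph G

  ind : Bool → ℚ
  ind true  = 1ℚ
  ind false = 0ℚ

  inCut outCut : Subset n → Fin m → ℚ
  inCut  S e = ind (lookup S (head e) ∧ not (lookup S (tail e)))
  outCut S e = ind (lookup S (tail e) ∧ not (lookup S (head e)))

  data BalancedIneq : (Fin m → ℚ) → ℚ → Set where
    cut-in   : (S : Subset n) → Nonempty S → Nonempty (∁ S) → BalancedIneq (inCut S) 1ℚ
    cut-out  : (S : Subset n) → Nonempty S → Nonempty (∁ S) → BalancedIneq (outCut S) 1ℚ
    bal-≥    : (v : Fin n) → BalancedIneq (λ e → outCut ⁅ v ⁆ e ℚ.- inCut ⁅ v ⁆ e) 0ℚ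
    bal-≤    : (v : Fin n) → BalancedIneq (λ e → inCut ⁅ v ⁆ e ℚ.- outCut ⁅ v ⁆ e) 0ℚ
    nonneg   : (i : Fin m) → BalancedIneq (λ e → ind (does (e ≟ i))) 0ℚ
    le-one   : (i : Fin m) → BalancedIneq (λ e → ℚ.- ind (does (e ≟ i))) (ℚ.- 1ℚ)

module _ {G : Digraph} (Dc : GoodDecomposition G) where
  open Digraph G
  open GoodDecomposition Dc

  g : Subset m → ℕ
  g S = ∣ tabulate (λ j → lookup F j ∧ any (lookup S) (C j)) ∣

  y∅ : ℕ → Subset m → ℚ
  y∅ t S = (ℤ.+ (suc (suc t)) ℤ.- ℤ.+ g S) ℚ./ suc (suc t)

-- Write c = 1/(t+2), w_j = [j ∈ F] and X_j = E ∖ E(C_j).  Then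
-- y_S = 1 - c·g(S) with g(S) = Σ_j w_j (1 - [S ⊆ X_j]), and inclusion–
-- exclusion, Σ_{T ⊆ Q} (-1)^{|T|} [S ∪ T ∪ R ⊆ X] = [S ∪ R ⊆ X][Q ∩ X = ∅],
-- turns every SA combination D(S,Q,R) of y into a closed form.  Pairing it
-- with an inequality Σ a_i x_i ≥ b, the SA constraint at (S,Q) becomes
--   * for Q ≠ ∅: a nonnegative combination of a(E ∖ E(C_j)) - b, j ∈ F
--     ("removal condition": deleting a cycle of F keeps the inequality);
--   * for Q = ∅: σ - c(σ g(S) + Σ_j w_j [S ⊆ X_j] a(C_j)) ≥ 0, σ = a(E) - b
--     ("level condition"), which follows from g(S) ≤ |S| ≤ t.

module Submission where

open import Defs
open import Data.Nat using (ℕ; suc)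
open import Data.Integer using (+_)
open import Data.Rational using (ℚ; _/_; 1ℚ)
open import Data.Fin.Subset using (_∈_; _∉_; ⁅_⁆)
open import Data.List.Membership.Propositional using () renaming (_∈_ to _∈ₗ_)
open import Data.Product using (_×_)
open import Relation.Binary.PropositionalEquality using (_≡_)

open import Data.Nat as ℕ using (zero)
import Data.Nat.Properties as ℕP
import Data.Integer as ℤ
import Data.Integer.Solver as ℤSolver
open import Data.Rational as ℚ using (0ℚ; _+_; _*_; -_; _-_; _≤_; toℚᵘ; fromℚᵘ)
import Data.Rational.Properties as ℚP
open import Data.Rational.Unnormalised as ℚᵘ using (mkℚᵘ; *≡*; *≤*)
import Data.Rational.Unnormalised.Properties as ℚᵘP
open import Data.Rational.Solver using (module +-*-Solver)
open +-*-Solver using (solve; _:+_; _:*_; :-_; _:-_; _:=_; con)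
open ℤSolver.+-*-Solver using () renaming
  (solve to ℤsolve; _:+_ to _ℤ+_; _:*_ to _ℤ*_; _:-_ to _ℤ-_; :-_ to ℤ-_; _:=_ to _ℤ=_; con to ℤcon)
open import Algebra.Bundles using (CommutativeRing)
open import Algebra.Properties.Semiring.Sum (CommutativeRing.semiring ℚP.+-*-commutativeRing)
  using (sum; ∑-distrib-+; ∑-comm; *-distribˡ-sum; sum-replicate-zero) renaming (sum-cong-≋ to sum-cong)
open import Data.Bool using (Bool; true; false; _∧_; _∨_; not)
import Data.Bool.Properties as BoolP
open import Data.Bool.ListAction using (any)
open import Data.Fin using (Fin; zero; suc; _≟_)
open import Data.Fin.Subset using (Subset; ∣_∣; _∪_; ⊤; ∁) renaming (⊥ to ∅)
open import Data.Fin.Subset.Properties using (_⊆?_)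
open import Data.Vec using (Vec; []; _∷_; lookup; tabulate)
open import Data.Vec.Properties using (lookup∘tabulate; lookup-map; []=⇒lookup; lookup⇒[]=)
open import Data.List as List using (List; []; _∷_; map; filter; _++_; allFin)
open import Data.List.Properties using (filter-++; map-tabulate)
open import Data.List.Relation.Unary.Any using (here; there; any?)
open import Data.List.Relation.Unary.All.Properties using (All¬⇒¬Any)
open import Data.List.Relation.Unary.AllPairs using (_∷_)
open import Data.List.Relation.Unary.Linked using (Linked; _∷_)
open import Data.List.Relation.Unary.Unique.Propositional using (Unique)
import Data.List.Relation.Unary.Unique.Propositional.Properties as UniqueP
open import Data.Product using (Σ; ∃; _,_)
open import Data.Empty using (⊥-elim)
open import Function using (_∘_)
open import Relation.Nullary using (¬_; does)
open import Relation.Nullary.Decidable using (dec-true; dec-false; yes; no)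
open import Relation.Unary using (Pred; Decidable)
open import Relation.Binary.PropositionalEquality using (_≢_; refl; sym; trans; cong; cong₂; subst; module ≡-Reasoning)

0≤+ : ∀ {p q} → 0ℚ ≤ p → 0ℚ ≤ q → 0ℚ ≤ p + q
0≤+ p≥0 q≥0 = ℚP.+-mono-≤ p≥0 q≥0

0≤* : ∀ {p q} → 0ℚ ≤ p → 0ℚ ≤ q → 0ℚ ≤ p * q
0≤* {p} {q} p≥0 q≥0 = ℚP.nonNegative⁻¹ _
  {{ℚP.nonNeg*nonNeg⇒nonNeg p {{ℚ.nonNegative p≥0}} q {{ℚ.nonNegative q≥0}}}}

≤⇒0≤- : ∀ {p q} → p ≤ q → 0ℚ ≤ q - p
≤⇒0≤- {p} p≤q = ℚP.≤-trans (ℚP.≤-reflexive (sym (ℚP.+-inverseʳ p))) (ℚP.+-monoˡ-≤ (- p) p≤q)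

0≤-⇒≤ : ∀ {p q} → 0ℚ ≤ q - p → p ≤ q
0≤-⇒≤ {p} {q} h = ℚP.≤-trans (ℚP.≤-reflexive (sym (ℚP.+-identityˡ p)))
  (ℚP.≤-trans (ℚP.+-monoˡ-≤ p h) (ℚP.≤-reflexive (solve 2 (λ p q → (q :- p) :+ p := q) refl p q)))

sum-zero : ∀ {n} → sum {n} (λ _ → 0ℚ) ≡ 0ℚ
sum-zero {n} = sum-replicate-zero n

sum-scale : ∀ {n} (k : ℚ) (f : Fin n → ℚ) → sum (λ i → k * f i) ≡ k * sum f
sum-scale k f = sym (*-distribˡ-sum k f)

sum-linear : ∀ {n} (α β : ℚ) (f g : Fin n → ℚ) →
  sum (λ i → α * f i + β * g i) ≡ α * sum f + β * sum g
sum-linear α β f g =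
  trans (∑-distrib-+ (λ i → α * f i) (λ i → β * g i)) (cong₂ _+_ (sum-scale α f) (sum-scale β g))

sum-nonneg : ∀ {n} (f : Fin n → ℚ) → (∀ i → 0ℚ ≤ f i) → 0ℚ ≤ sum f
sum-nonneg {zero}  f f≥0 = ℚP.≤-refl
sum-nonneg {suc n} f f≥0 = 0≤+ (f≥0 zero) (sum-nonneg (f ∘ suc) (f≥0 ∘ suc))

sum-mono : ∀ {n} (f g : Fin n → ℚ) → (∀ i → f i ≤ g i) → sum f ≤ sum g
sum-mono {zero}  f g f≤g = ℚP.≤-refl
sum-mono {suc n} f g f≤g = ℚP.+-mono-≤ (f≤g zero) (sum-mono (f ∘ suc) (g ∘ suc) (f≤g ∘ suc))

term≤sum : ∀ {n} (f : Fin n → ℚ) → (∀ i → 0ℚ ≤ f i) → ∀ i → f i ≤ sum f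
term≤sum f f≥0 zero = ℚP.≤-trans (ℚP.≤-reflexive (sym (ℚP.+-identityʳ (f zero))))
  (ℚP.+-monoʳ-≤ (f zero) (sum-nonneg (f ∘ suc) (f≥0 ∘ suc)))
term≤sum f f≥0 (suc i) = ℚP.≤-trans (ℚP.≤-reflexive (sym (ℚP.+-identityˡ (f (suc i)))))
  (ℚP.+-mono-≤ (f≥0 zero) (term≤sum (f ∘ suc) (f≥0 ∘ suc) i))

χ : Bool → ℚ
χ true  = 1ℚ
χ false = 0ℚ

χ-nonneg : ∀ b → 0ℚ ≤ χ b
χ-nonneg true  = ℚP.nonNegative⁻¹ 1ℚ
χ-nonneg false = ℚP.≤-refl

χ-≤1 : ∀ b → χ b ≤ 1ℚ
χ-≤1 true  = ℚP.≤-refl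
χ-≤1 false = ℚP.nonNegative⁻¹ 1ℚ

χ-∧ : ∀ a b → χ (a ∧ b) ≡ χ a * χ b
χ-∧ true  b = sym (ℚP.*-identityˡ (χ b))
χ-∧ false b = sym (ℚP.*-zeroˡ (χ b))

χ-not : ∀ a → χ (not a) ≡ 1ℚ - χ a
χ-not true  = refl
χ-not false = refl

ind≡χ : (G : Digraph) → ∀ b → ind G b ≡ χ b
ind≡χ G true  = refl
ind≡χ G false = refl

sum-δ : ∀ {n} (f : Fin n → ℚ) (e : Fin n) → sum (λ i → χ (does (i ≟ e)) * f i) ≡ f e
sum-δ {suc n} f zero = trans
  (cong₂ _+_ (ℚP.*-identityˡ (f zero)) (trans (sum-cong (λ i → ℚP.*-zeroˡ (f (suc i)))) (sum-zero {n})))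
  (ℚP.+-identityʳ (f zero))
sum-δ {suc n} f (suc e) = trans
  (cong₂ _+_ (ℚP.*-zeroˡ (f zero))
    (trans (sum-cong (λ i → cong (λ b → χ b * f (suc i)) (suc-≟ i))) (sum-δ (f ∘ suc) e)))
  (ℚP.+-identityˡ (f (suc e)))
  where
  suc-≟ : ∀ i → does (suc i ≟ suc e) ≡ does (i ≟ e)
  suc-≟ i with i ≟ e
  ... | yes _ = refl
  ... | no  _ = refl

-- Natural numbers inside ℚ.  Identities between normalised rationals
-- are proved by passing to unnormalised ones, where they are integer
-- ring identities.

fromℕ : ℕ → ℚ
fromℕ n = + n / 1

toℚᵘ-/ : ∀ p d → toℚᵘ (fromℚᵘ (mkℚᵘ p d)) ℚᵘ.≃ mkℚᵘ p d
toℚᵘ-/ p d = ℚP.toℚᵘ-fromℚᵘ (mkℚᵘ p d)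

fromℕ-suc : ∀ n → fromℕ (suc n) ≡ 1ℚ + fromℕ n
fromℕ-suc n = ℚP.toℚᵘ-injective (ℚᵘP.≃-trans (toℚᵘ-/ (+ suc n) 0) (ℚᵘP.≃-sym
  (ℚᵘP.≃-trans (ℚP.toℚᵘ-homo-+ 1ℚ (fromℕ n)) (ℚᵘP.≃-trans (ℚᵘP.+-congʳ (toℚᵘ 1ℚ) (toℚᵘ-/ (+ n) 0))
    (*≡* (ℤsolve 1 (λ x → (ℤcon (+ 1) ℤ* ℤcon (+ 1) ℤ+ x ℤ* ℤcon (+ 1)) ℤ* ℤcon (+ 1)
                       ℤ= (ℤcon (+ 1) ℤ+ x) ℤ* (ℤcon (+ 1) ℤ* ℤcon (+ 1))) refl (+ n)))))))

fromℕ-+ : ∀ a b → fromℕ (a ℕ.+ b) ≡ fromℕ a + fromℕ b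
fromℕ-+ zero    b = sym (ℚP.+-identityˡ (fromℕ b))
fromℕ-+ (suc a) b = begin
  fromℕ (suc (a ℕ.+ b))        ≡⟨ fromℕ-suc (a ℕ.+ b) ⟩
  1ℚ + fromℕ (a ℕ.+ b)         ≡⟨ cong (λ z → 1ℚ + z) (fromℕ-+ a b) ⟩
  1ℚ + (fromℕ a + fromℕ b)     ≡⟨ sym (ℚP.+-assoc 1ℚ (fromℕ a) (fromℕ b)) ⟩
  (1ℚ + fromℕ a) + fromℕ b     ≡⟨ cong (_+ fromℕ b) (sym (fromℕ-suc a)) ⟩
  fromℕ (suc a) + fromℕ b      ∎
  where open ≡-Reasoning

fromℕ-nonneg : ∀ n → 0ℚ ≤ fromℕ n
fromℕ-nonneg zero    = ℚP.≤-refl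
fromℕ-nonneg (suc n) = subst (0ℚ ≤_) (sym (fromℕ-suc n)) (0≤+ (χ-nonneg true) (fromℕ-nonneg n))

fromℕ-mono : ∀ {a b} → a ℕ.≤ b → fromℕ a ≤ fromℕ b
fromℕ-mono {a} a≤b with ℕP.m≤n⇒∃[o]m+o≡n a≤b
... | o , refl = ℚP.≤-trans (ℚP.≤-reflexive (sym (ℚP.+-identityʳ (fromℕ a))))
  (ℚP.≤-trans (ℚP.+-monoʳ-≤ (fromℕ a) (fromℕ-nonneg o)) (ℚP.≤-reflexive (sym (fromℕ-+ a o))))

∣∣-as-sum : ∀ {n} (v : Vec Bool n) → fromℕ ∣ v ∣ ≡ sum (λ j → χ (lookup v j))
∣∣-as-sum []          = refl
∣∣-as-sum (true ∷ v)  = trans (fromℕ-suc ∣ v ∣) (cong (λ z → 1ℚ + z) (∣∣-as-sum v))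
∣∣-as-sum (false ∷ v) = trans (∣∣-as-sum v) (sym (ℚP.+-identityˡ _))

sum-χ-integral : ∀ {n} (β : Fin n → Bool) → ∃ λ k → sum (λ i → χ (β i)) ≡ fromℕ k
sum-χ-integral {zero}  β = 0 , refl
sum-χ-integral {suc n} β with sum-χ-integral (β ∘ suc) | β zero
... | k , eq | true  = suc k , trans (cong (λ z → 1ℚ + z) eq) (sym (fromℕ-suc k))
... | k , eq | false = k , trans (cong (λ z → 0ℚ + z) eq) (ℚP.+-identityˡ (fromℕ k))

scale : ℕ → ℚ
scale t = + 1 / suc (suc t)

scale-nonneg : ∀ t → 0ℚ ≤ scale t
scale-nonneg t = ℚP.toℚᵘ-cancel-≤
  (ℚᵘP.≤-respʳ-≃ (ℚᵘP.≃-sym (toℚᵘ-/ (+ 1) (suc t))) (*≤* (ℤ.+≤+ ℕ.z≤n)))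

scale-inverse : ∀ t → 1ℚ ≡ scale t * (1ℚ + (1ℚ + fromℕ t))
scale-inverse t = begin
  1ℚ                                    ≡⟨ sym (ℚP.toℚᵘ-injective cancel) ⟩
  scale t * fromℕ (suc (suc t))         ≡⟨ cong (scale t *_) (fromℕ-suc (suc t)) ⟩
  scale t * (1ℚ + fromℕ (suc t))        ≡⟨ cong (λ z → scale t * (1ℚ + z)) (fromℕ-suc t) ⟩
  scale t * (1ℚ + (1ℚ + fromℕ t))       ∎
  where
  open ≡-Reasoning
  cancel : toℚᵘ (scale t * fromℕ (suc (suc t))) ℚᵘ.≃ toℚᵘ 1ℚ
  cancel = ℚᵘP.≃-trans (ℚP.toℚᵘ-homo-* (scale t) (fromℕ (suc (suc t))))
    (ℚᵘP.≃-trans (ℚᵘP.*-cong (toℚᵘ-/ (+ 1) (suc t)) (toℚᵘ-/ (+ suc (suc t)) 0))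
    (*≡* (ℤsolve 1 (λ x → (ℤcon (+ 1) ℤ* x) ℤ* ℤcon (+ 1) ℤ= ℤcon (+ 1) ℤ* (x ℤ* ℤcon (+ 1)))
                 refl (+ suc (suc t)))))

y-normal-form : ∀ t g → (+ suc (suc t) ℤ.- + g) / suc (suc t) ≡ 1ℚ - scale t * fromℕ g
y-normal-form t g = ℚP.toℚᵘ-injective (ℚᵘP.≃-trans (toℚᵘ-/ (+ suc (suc t) ℤ.- + g) (suc t))
  (ℚᵘP.≃-sym (ℚᵘP.≃-trans (ℚP.toℚᵘ-homo-+ 1ℚ (- (scale t * fromℕ g)))
    (ℚᵘP.≃-trans (ℚᵘP.+-congʳ (toℚᵘ 1ℚ) (ℚᵘP.≃-trans (ℚP.toℚᵘ-homo‿- (scale t * fromℕ g))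
      (ℚᵘP.-‿cong (ℚᵘP.≃-trans (ℚP.toℚᵘ-homo-* (scale t) (fromℕ g))
        (ℚᵘP.*-cong (toℚᵘ-/ (+ 1) (suc t)) (toℚᵘ-/ (+ g) 0))))))
    (*≡* (ℤsolve 2 (λ x y → (ℤcon (+ 1) ℤ* (x ℤ* ℤcon (+ 1)) ℤ+ (ℤ- (ℤcon (+ 1) ℤ* y)) ℤ* ℤcon (+ 1)) ℤ* x
                          ℤ= (x ℤ- y) ℤ* (ℤcon (+ 1) ℤ* (x ℤ* ℤcon (+ 1))))
               refl (+ suc (suc t)) (+ g)))))))

infix 4 _⊆ᵇ_ _#ᵇ_

_⊆ᵇ_ : ∀ {m} → Subset m → Subset m → Bool
[]      ⊆ᵇ []      = true
(u ∷ U) ⊆ᵇ (b ∷ x) = (not u ∨ b) ∧ (U ⊆ᵇ x)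

_#ᵇ_ : ∀ {m} → Subset m → Subset m → Bool
[]      #ᵇ []      = true
(q ∷ Q) #ᵇ (b ∷ x) = not (q ∧ b) ∧ (Q #ᵇ x)

⊆ᵇ-⊤ : ∀ {m} (U : Subset m) → (U ⊆ᵇ ⊤) ≡ true
⊆ᵇ-⊤ []          = refl
⊆ᵇ-⊤ (true ∷ U)  = ⊆ᵇ-⊤ U
⊆ᵇ-⊤ (false ∷ U) = ⊆ᵇ-⊤ U

#ᵇ-⊤ : ∀ {m} (Q x : Subset m) → (Q #ᵇ ⊤) ≡ true → (Q #ᵇ x) ≡ true
#ᵇ-⊤ []          []      _  = refl
#ᵇ-⊤ (false ∷ Q) (b ∷ x) eq = #ᵇ-⊤ Q x eq

∪∅-⊆ᵇ : ∀ {m} (S x : Subset m) → (S ∪ ∅ ⊆ᵇ x) ≡ (S ⊆ᵇ x)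
∪∅-⊆ᵇ []      []      = refl
∪∅-⊆ᵇ (s ∷ S) (b ∷ x) = cong₂ (λ u v → (not u ∨ b) ∧ v) (BoolP.∨-identityʳ s) (∪∅-⊆ᵇ S x)

∪⁅⁆-⊆ᵇ : ∀ {m} (S x : Subset m) i → (S ∪ ⁅ i ⁆ ⊆ᵇ x) ≡ (S ⊆ᵇ x) ∧ lookup x i
∪⁅⁆-⊆ᵇ (s ∷ S) (b ∷ x) zero =
  trans (cong (λ v → (not (s ∨ true) ∨ b) ∧ v) (∪∅-⊆ᵇ S x)) (head-case s b (S ⊆ᵇ x))
  where
  head-case : ∀ s b l → ((not (s ∨ true) ∨ b) ∧ l) ≡ (((not s ∨ b) ∧ l) ∧ b)
  head-case true  true  true  = refl
  head-case true  true  false = refl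
  head-case true  false l     = refl
  head-case false true  true  = refl
  head-case false true  false = refl
  head-case false false true  = refl
  head-case false false false = refl
∪⁅⁆-⊆ᵇ (s ∷ S) (b ∷ x) (suc i) =
  trans (cong₂ (λ u v → (not u ∨ b) ∧ v) (BoolP.∨-identityʳ s) (∪⁅⁆-⊆ᵇ S x i))
        (sym (BoolP.∧-assoc (not s ∨ b) (S ⊆ᵇ x) (lookup x i)))

⊆ᵇ-sound : ∀ {m} (U x : Subset m) → (U ⊆ᵇ x) ≡ true → ∀ i → lookup U i ≡ true → lookup x i ≡ true
⊆ᵇ-sound (true  ∷ U) (true ∷ x) h zero    _  = refl
⊆ᵇ-sound (true  ∷ U) (true ∷ x) h (suc i) Ui = ⊆ᵇ-sound U x h i Ui
⊆ᵇ-sound (false ∷ U) (b ∷ x)    h (suc i) Ui = ⊆ᵇ-sound U x h i Ui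
⊆ᵇ-sound (true  ∷ U) (false ∷ x) () i      Ui
⊆ᵇ-sound (false ∷ U) (b ∷ x)    h zero    ()

⊆ᵇ-witness : ∀ {m} (U x : Subset m) → (U ⊆ᵇ x) ≡ false → Σ (Fin m) λ i → lookup U i ≡ true × lookup x i ≡ false
⊆ᵇ-witness []          []          ()
⊆ᵇ-witness (true ∷ U) (false ∷ x) _ = zero , refl , refl
⊆ᵇ-witness (true ∷ U) (true ∷ x) h with ⊆ᵇ-witness U x h
... | i , Ui , xi = suc i , Ui , xi
⊆ᵇ-witness (false ∷ U) (b ∷ x) h with ⊆ᵇ-witness U x h
... | i , Ui , xi = suc i , Ui , xi

false≢true : false ≢ true
false≢true ()

lookup-⁅⁆ : ∀ {m} (e i : Fin m) → lookup ⁅ e ⁆ i ≡ does (e ≟ i)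
lookup-⁅⁆ zero    zero    = refl
lookup-⁅⁆ zero    (suc i) = lookup-∅ i
  where
  lookup-∅ : ∀ {m} (i : Fin m) → lookup ∅ i ≡ false
  lookup-∅ zero    = refl
  lookup-∅ (suc i) = lookup-∅ i
lookup-⁅⁆ (suc e) zero    = refl
lookup-⁅⁆ (suc e) (suc i) = lookup-⁅⁆ e i

infix 4 _∈ᵇ_

_∈ᵇ_ : ∀ {m} → Fin m → List (Fin m) → Bool
i ∈ᵇ L = does (any? (i ≟_) L)

∈ᵇ-sound : ∀ {m} {i : Fin m} L → (i ∈ᵇ L) ≡ true → i ∈ₗ L
∈ᵇ-sound {i = i} L h with any? (i ≟_) L
∈ᵇ-sound L _  | yes i∈L = i∈L
∈ᵇ-sound L () | no _

∈⇒∈ᵇ : ∀ {m} {i : Fin m} {L} → i ∈ₗ L → (i ∈ᵇ L) ≡ true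
∈⇒∈ᵇ {i = i} {L} = dec-true (any? (i ≟_) L)

∉⇒∈ᵇ : ∀ {m} {i : Fin m} {L} → ¬ i ∈ₗ L → (i ∈ᵇ L) ≡ false
∉⇒∈ᵇ {i = i} {L} = dec-false (any? (i ≟_) L)

∈ᵇ-⁅⁆ : ∀ {m} (e : Fin m) L → any (lookup ⁅ e ⁆) L ≡ (e ∈ᵇ L)
∈ᵇ-⁅⁆ e []      = refl
∈ᵇ-⁅⁆ e (x ∷ L) = cong₂ _∨_ (lookup-⁅⁆ e x) (∈ᵇ-⁅⁆ e L)

outside : ∀ {m} → List (Fin m) → Subset m
outside L = tabulate (λ i → not (i ∈ᵇ L))

lookup-outside : ∀ {m} (L : List (Fin m)) i → lookup (outside L) i ≡ not (i ∈ᵇ L)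
lookup-outside L = lookup∘tabulate (λ i → not (i ∈ᵇ L))

any-witness : ∀ {A : Set} (p : A → Bool) L → any p L ≡ true → Σ A λ e → e ∈ₗ L × p e ≡ true
any-witness p (x ∷ L) h with p x in px
... | true  = x , here refl , px
... | false with any-witness p L h
...   | e , e∈L , pe = e , there e∈L , pe

any-intro : ∀ {A : Set} (p : A → Bool) {e} L → e ∈ₗ L → p e ≡ true → any p L ≡ true
any-intro p (x ∷ L) (here refl) pe = cong (_∨ any p L) pe
any-intro p (x ∷ L) (there e∈L) pe = trans (cong (p x ∨_) (any-intro p L e∈L pe)) (BoolP.∨-zeroʳ _)

misses⇔⊆ᵇ-outside : ∀ {m} (U : Subset m) L → not (any (lookup U) L) ≡ (U ⊆ᵇ outside L)
misses⇔⊆ᵇ-outside U L with any (lookup U) L in meets | U ⊆ᵇ outside L in inside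
... | true  | false = refl
... | false | true  = refl
... | true  | true  with any-witness (lookup U) L meets
...   | e , e∈L , Ue = ⊥-elim (false≢true (begin
        false                    ≡⟨ cong not (sym (∈⇒∈ᵇ e∈L)) ⟩
        not (e ∈ᵇ L)             ≡⟨ sym (lookup-outside L e) ⟩
        lookup (outside L) e     ≡⟨ ⊆ᵇ-sound U (outside L) inside e Ue ⟩
        true                     ∎))
  where open ≡-Reasoning
misses⇔⊆ᵇ-outside U L | false | false with ⊆ᵇ-witness U (outside L) inside
...   | i , Ui , outside-i = ⊥-elim (false≢true (trans (sym meets) (any-intro (lookup U) L (∈ᵇ-sound L i∈ᵇL) Ui)))
  where
  i∈ᵇL : (i ∈ᵇ L) ≡ true
  i∈ᵇL = trans (sym (BoolP.not-involutive _)) (cong not (trans (sym (lookup-outside L i)) outside-i))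

sumL : ∀ {A : Set} → (A → ℚ) → List A → ℚ
sumL h L = sumℚ (map h L)

sumL-++ : ∀ {A : Set} (h : A → ℚ) xs ys → sumL h (xs ++ ys) ≡ sumL h xs + sumL h ys
sumL-++ h []       ys = sym (ℚP.+-identityˡ _)
sumL-++ h (x ∷ xs) ys = trans (cong (λ z → h x + z) (sumL-++ h xs ys)) (sym (ℚP.+-assoc (h x) _ _))

sumL-cong : ∀ {A : Set} {h h′ : A → ℚ} → (∀ x → h x ≡ h′ x) → ∀ L → sumL h L ≡ sumL h′ L
sumL-cong eq []      = refl
sumL-cong eq (x ∷ L) = cong₂ _+_ (eq x) (sumL-cong eq L)

sumL-scale : ∀ {A : Set} (k : ℚ) (h : A → ℚ) L → sumL (λ x → k * h x) L ≡ k * sumL h L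
sumL-scale k h []      = sym (ℚP.*-zeroʳ k)
sumL-scale k h (x ∷ L) = trans (cong (λ z → k * h x + z) (sumL-scale k h L)) (sym (ℚP.*-distribˡ-+ k (h x) _))

sumL-filter-map : ∀ {A B : Set} {p q} {P : Pred B p} {Q : Pred A q} (P? : Decidable P) (Q? : Decidable Q)
  (f : A → B) (h : B → ℚ) → (∀ x → does (P? (f x)) ≡ does (Q? x)) →
  ∀ L → sumL h (filter P? (map f L)) ≡ sumL (h ∘ f) (filter Q? L)
sumL-filter-map P? Q? f h agree []      = refl
sumL-filter-map P? Q? f h agree (x ∷ L) with P? (f x) | Q? x | agree x
... | yes _ | yes _ | _ = cong (λ z → h (f x) + z) (sumL-filter-map P? Q? f h agree L)
... | no _  | no _  | _ = sumL-filter-map P? Q? f h agree L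

sumL-filter-none : ∀ {A B : Set} {p} {P : Pred B p} (P? : Decidable P) (f : A → B) (h : B → ℚ) →
  (∀ x → does (P? (f x)) ≡ false) → ∀ L → sumL h (filter P? (map f L)) ≡ 0ℚ
sumL-filter-none P? f h none []      = refl
sumL-filter-none P? f h none (x ∷ L) with P? (f x) | none x
... | no _ | _ = sumL-filter-none P? f h none L

χ-∨-not : ∀ u b → χ (u ∨ b) + - χ b ≡ χ (u ∨ b) * χ (not b)
χ-∨-not true  true  = refl
χ-∨-not true  false = refl
χ-∨-not false true  = refl
χ-∨-not false false = refl

IE-sum : ∀ {m} (x S Q R : Subset m) → ℚ
IE-sum {m} x S Q R = sumL (λ T → sgn ∣ T ∣ * χ (S ∪ T ∪ R ⊆ᵇ x)) (filter (_⊆? Q) (subsets m))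

inclusion-exclusion : ∀ {m} (x S Q R : Subset m) → IE-sum x S Q R ≡ χ (S ∪ R ⊆ᵇ x) * χ (Q #ᵇ x)
inclusion-exclusion {zero}  []      []      []      []      = refl
inclusion-exclusion {suc m} (b ∷ x) (s ∷ S) (q ∷ Q) (r ∷ R) = begin
  sumL H (filter (_⊆? (q ∷ Q)) (map (false ∷_) Ts ++ map (true ∷_) Ts))
    ≡⟨ cong (sumL H) (filter-++ (_⊆? (q ∷ Q)) (map (false ∷_) Ts) (map (true ∷_) Ts)) ⟩
  sumL H (filter (_⊆? (q ∷ Q)) (map (false ∷_) Ts) ++ filter (_⊆? (q ∷ Q)) (map (true ∷_) Ts))
    ≡⟨ sumL-++ H (filter (_⊆? (q ∷ Q)) (map (false ∷_) Ts)) _ ⟩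
  sumL H (filter (_⊆? (q ∷ Q)) (map (false ∷_) Ts)) + sumL H (filter (_⊆? (q ∷ Q)) (map (true ∷_) Ts))
    ≡⟨ cong₂ _+_ without-new (with-new q) ⟩
  c₀ * V + W q
    ≡⟨ combine q ⟩
  χ ((s ∷ S) ∪ (r ∷ R) ⊆ᵇ b ∷ x) * χ ((q ∷ Q) #ᵇ b ∷ x)
    ∎
  where
  open ≡-Reasoning
  Ts = subsets m
  H : Subset (suc m) → ℚ
  H T = sgn ∣ T ∣ * χ ((s ∷ S) ∪ T ∪ (r ∷ R) ⊆ᵇ b ∷ x)
  V = IE-sum x S Q R
  -- the new coordinate is fine for the inclusion when it is not in S ∪ R or lies in x
  c₀ = χ (not (s ∨ r) ∨ b)
  -- subsets T avoiding the new coordinate contribute c₀ times the old sum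
  without-new : sumL H (filter (_⊆? (q ∷ Q)) (map (false ∷_) Ts)) ≡ c₀ * V
  without-new = trans (sumL-filter-map (_⊆? (q ∷ Q)) (_⊆? Q) (false ∷_) H (λ _ → refl) Ts)
    (trans (sumL-cong (λ T → trans (cong (sgn ∣ T ∣ *_) (χ-∧ (not (s ∨ r) ∨ b) _))
                                   (solve 3 (λ a b c → a :* (b :* c) := b :* (a :* c)) refl (sgn ∣ T ∣) c₀ _))
                      (filter (_⊆? Q) Ts))
           (sumL-scale c₀ _ (filter (_⊆? Q) Ts)))
  -- subsets T containing it exist only if q, and contribute -[b] times the old sum
  W : Bool → ℚ
  W false = 0ℚ
  W true  = - (χ b * V)
  with-new : ∀ q → sumL H (filter (_⊆? (q ∷ Q)) (map (true ∷_) Ts)) ≡ W q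
  with-new false = sumL-filter-none (_⊆? (false ∷ Q)) (true ∷_) H (λ _ → refl) Ts
  with-new true = trans (sumL-filter-map (_⊆? (true ∷ Q)) (_⊆? Q) (true ∷_) H (λ _ → refl) Ts)
    (trans (sumL-cong (λ T → trans (cong (λ z → - sgn ∣ T ∣ * χ ((not z ∨ b) ∧ (S ∪ T ∪ R ⊆ᵇ x))) (s∨true s))
                            (trans (cong (- sgn ∣ T ∣ *_) (χ-∧ b _))
                              (solve 3 (λ a b c → (:- a) :* (b :* c) := (:- b) :* (a :* c)) refl (sgn ∣ T ∣) (χ b) _)))
                      (filter (_⊆? Q) Ts))
    (trans (sumL-scale (- χ b) _ (filter (_⊆? Q) Ts)) (sym (ℚP.neg-distribˡ-* (χ b) V))))
    where
    s∨true : ∀ s → (s ∨ (true ∨ r)) ≡ true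
    s∨true true  = refl
    s∨true false = refl
  A = χ (S ∪ R ⊆ᵇ x)
  B = χ (Q #ᵇ x)
  combine : ∀ q → c₀ * V + W q ≡ χ ((s ∷ S) ∪ (r ∷ R) ⊆ᵇ b ∷ x) * χ ((q ∷ Q) #ᵇ b ∷ x)
  combine false = begin
    c₀ * V + 0ℚ         ≡⟨ cong (λ z → c₀ * z + 0ℚ) (inclusion-exclusion x S Q R) ⟩
    c₀ * (A * B) + 0ℚ   ≡⟨ solve 3 (λ c a b → c :* (a :* b) :+ con 0ℚ := (c :* a) :* b) refl c₀ A B ⟩
    (c₀ * A) * B        ≡⟨ cong (_* B) (sym (χ-∧ (not (s ∨ r) ∨ b) _)) ⟩
    _                   ∎
  combine true = begin
    c₀ * V + - (χ b * V)              ≡⟨ cong (λ z → c₀ * z + - (χ b * z)) (inclusion-exclusion x S Q R) ⟩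
    c₀ * (A * B) + - (χ b * (A * B))  ≡⟨ solve 4 (λ c d a b → c :* (a :* b) :+ (:- (d :* (a :* b))) := (c :+ (:- d)) :* (a :* b)) refl c₀ (χ b) A B ⟩
    (c₀ + - χ b) * (A * B)            ≡⟨ cong (_* (A * B)) (χ-∨-not (not (s ∨ r)) b) ⟩
    (c₀ * χ (not b)) * (A * B)        ≡⟨ solve 4 (λ c n a b → (c :* n) :* (a :* b) := (c :* a) :* (n :* b)) refl c₀ (χ (not b)) A B ⟩
    (c₀ * A) * (χ (not b) * B)        ≡⟨ sym (cong₂ _*_ (χ-∧ (not (s ∨ r) ∨ b) _) (χ-∧ (not b) _)) ⟩
    _                                 ∎

sumL-affine : ∀ {A : Set} {N} (c : ℚ) (w : Fin N → ℚ) (s : A → ℚ) (p : Fin N → A → ℚ) L →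
  sumL (λ T → s T * (1ℚ - c * sum (λ j → w j * (1ℚ - p j T)))) L ≡
  sumL s L - c * sum (λ j → w j * (sumL s L - sumL (λ T → s T * p j T) L))
sumL-affine {N = N} c w s p [] = sym (begin
  0ℚ - c * sum (λ j → w j * (0ℚ - 0ℚ))   ≡⟨ cong (λ z → 0ℚ - c * z) (trans (sum-cong (λ j → ℚP.*-zeroʳ (w j))) (sum-zero {N})) ⟩
  0ℚ - c * 0ℚ                            ≡⟨ solve 1 (λ c → con 0ℚ :- c :* con 0ℚ := con 0ℚ) refl c ⟩
  0ℚ                                     ∎)
  where open ≡-Reasoning
sumL-affine {N = N} c w s p (x ∷ L) = begin
  s x * (1ℚ - c * Φ) + sumL (λ T → s T * (1ℚ - c * sum (λ j → w j * (1ℚ - p j T)))) L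
    ≡⟨ cong (λ z → s x * (1ℚ - c * Φ) + z) (sumL-affine c w s p L) ⟩
  s x * (1ℚ - c * Φ) + (Σs - c * Ψ)
    ≡⟨ solve 5 (λ sx c Φ A Ψ → sx :* (con 1ℚ :- c :* Φ) :+ (A :- c :* Ψ) := (sx :+ A) :- c :* (sx :* Φ :+ Ψ)) refl (s x) c Φ Σs Ψ ⟩
  (s x + Σs) - c * (s x * Φ + Ψ)
    ≡⟨ cong (λ z → (s x + Σs) - c * z) (sym (trans (sum-cong split) (trans (∑-distrib-+ (λ j → s x * (w j * (1ℚ - p j x))) (λ j → w j * (Σs - Σsp j))) (cong (_+ Ψ) (sum-scale (s x) (λ j → w j * (1ℚ - p j x))))))) ⟩
  (s x + Σs) - c * sum (λ j → w j * ((s x + Σs) - (s x * p j x + Σsp j)))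
    ∎
  where
  open ≡-Reasoning
  Φ  = sum (λ j → w j * (1ℚ - p j x))
  Σs = sumL s L
  Σsp : Fin N → ℚ
  Σsp j = sumL (λ T → s T * p j T) L
  Ψ  = sum (λ j → w j * (Σs - Σsp j))
  split : ∀ j → w j * ((s x + Σs) - (s x * p j x + Σsp j)) ≡ s x * (w j * (1ℚ - p j x)) + w j * (Σs - Σsp j)
  split j = solve 5 (λ w sx A px B → w :* ((sx :+ A) :- (sx :* px :+ B)) := sx :* (w :* (con 1ℚ :- px)) :+ w :* (A :- B))
    refl (w j) (s x) Σs (p j x) (Σsp j)

-- Pairing the closed forms of D(S,Q,{i}) and D(S,Q,∅) with an inequality
-- (a , b):  Σ_i a_i D_i - b D_∅  collapses to one sum over the cycles.
SA-pairing : ∀ {m N} (a : Fin m → ℚ) b c Z (w P Zj : Fin N → ℚ) (x : Fin N → Fin m → ℚ) →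
  sum (λ i → a i * (Z - c * sum (λ j → w j * (Z - (P j * x j i) * Zj j)))) - b * (Z - c * sum (λ j → w j * (Z - P j * Zj j)))
  ≡ Z * (sum a - b) - c * sum (λ j → w j * (Z * (sum a - b) - P j * Zj j * (sum (λ i → a i * x j i) - b)))
SA-pairing {m} {N} a b c Z w P Zj x = begin
  sum (λ i → a i * (Z - c * sum (h i))) - b * (Z - c * ΣN)
    ≡⟨ cong (_- b * (Z - c * ΣN)) expand ⟩
  (Z * Σa + (- c) * sum (λ i → sum (λ j → a i * h i j))) - b * (Z - c * ΣN)
    ≡⟨ cong (λ z → (Z * Σa + (- c) * z) - b * (Z - c * ΣN)) (trans (∑-comm (λ i j → a i * h i j)) (sum-cong per-cycle)) ⟩
  (Z * Σa + (- c) * sum M) - b * (Z - c * ΣN)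
    ≡⟨ solve 6 (λ Z Σa c ΣM b ΣN → (Z :* Σa :+ (:- c) :* ΣM) :- b :* (Z :- c :* ΣN) := Z :* (Σa :- b) :- c :* (con 1ℚ :* ΣM :+ (:- b) :* ΣN)) refl Z Σa c (sum M) b ΣN ⟩
  Z * (Σa - b) - c * (1ℚ * sum M + (- b) * ΣN)
    ≡⟨ cong (λ z → Z * (Σa - b) - c * z) (trans (sym (sum-linear 1ℚ (- b) M Nf)) (sum-cong collect)) ⟩
  Z * (Σa - b) - c * sum (λ j → w j * (Z * (Σa - b) - P j * Zj j * (ax j - b)))
    ∎
  where
  open ≡-Reasoning
  Σa = sum a
  h : Fin m → Fin N → ℚ
  h i j = w j * (Z - (P j * x j i) * Zj j)
  Nf : Fin N → ℚ
  Nf j = w j * (Z - P j * Zj j)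
  ΣN = sum Nf
  ax : Fin N → ℚ
  ax j = sum (λ i → a i * x j i)
  M : Fin N → ℚ
  M j = (w j * Z) * Σa + (- (w j * P j * Zj j)) * ax j
  expand : sum (λ i → a i * (Z - c * sum (h i))) ≡ Z * Σa + (- c) * sum (λ i → sum (λ j → a i * h i j))
  expand = trans (sum-cong (λ i → trans
      (solve 4 (λ a Z c K → a :* (Z :- c :* K) := Z :* a :+ (:- c) :* (a :* K)) refl (a i) Z c (sum (h i)))
      (cong (λ z → Z * a i + (- c) * z) (sym (sum-scale (a i) (h i))))))
    (sum-linear Z (- c) a (λ i → sum (λ j → a i * h i j)))
  per-cycle : ∀ j → sum (λ i → a i * h i j) ≡ M j
  per-cycle j = trans (sum-cong (λ i → solve 6
      (λ a w Z P x Zj → a :* (w :* (Z :- (P :* x) :* Zj)) := (w :* Z) :* a :+ (:- (w :* P :* Zj)) :* (a :* x))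
      refl (a i) (w j) Z (P j) (x j i) (Zj j)))
    (sum-linear (w j * Z) (- (w j * P j * Zj j)) a (λ i → a i * x j i))
  collect : ∀ j → 1ℚ * M j + (- b) * Nf j ≡ w j * (Z * (Σa - b) - P j * Zj j * (ax j - b))
  collect j = solve 7 (λ w Z Σa P Zj ax b → con 1ℚ :* ((w :* Z) :* Σa :+ (:- (w :* P :* Zj)) :* ax) :+ (:- b) :* (w :* (Z :- P :* Zj))
                                     := w :* (Z :* (Σa :- b) :- P :* Zj :* (ax :- b)))
    refl (w j) Z Σa (P j) (Zj j) (ax j) b

sum-allFin : ∀ {n} (f : Fin n → ℚ) → sumℚ (map f (allFin n)) ≡ sum f
sum-allFin {n} f = trans (cong sumℚ (map-tabulate {n = n} (λ i → i) f)) (sum-tabulate f)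
  where
  sum-tabulate : ∀ {n} (f : Fin n → ℚ) → sumℚ (List.tabulate f) ≡ sum f
  sum-tabulate {zero}  f = refl
  sum-tabulate {suc n} f = cong (λ z → f zero + z) (sum-tabulate (f ∘ suc))

-- Throughout,
-- c = 1/(t+2), w_j = [j ∈ F], X_j = E ∖ E(C_j), and for subsets U, Q
--   avoids U j = [U ∩ E(C_j) = ∅],  isEmpty Q = [Q = ∅],  within Q j = [Q ⊆ E(C_j)].

module ClosedForm (G : Digraph) (Dc : GoodDecomposition G) (t : ℕ) where
  open Digraph G
  open GoodDecomposition Dc

  c : ℚ
  c = scale t

  w : Fin N → ℚ
  w j = χ (lookup F j)

  X : Fin N → Subset m
  X j = outside (C j)

  avoids : Subset m → Fin N → ℚ
  avoids U j = χ (U ⊆ᵇ X j)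

  isEmpty : Subset m → ℚ
  isEmpty Q = χ (Q #ᵇ ⊤)

  within : Subset m → Fin N → ℚ
  within Q j = χ (Q #ᵇ X j)

  gℚ : Subset m → ℚ
  gℚ U = sum (λ j → w j * (1ℚ - avoids U j))

  g-as-sum : ∀ U → fromℕ (g Dc U) ≡ gℚ U
  g-as-sum U = trans (∣∣-as-sum (tabulate (λ j → lookup F j ∧ any (lookup U) (C j))))
    (sum-cong (λ j → trans (cong χ (lookup∘tabulate _ j)) (trans (χ-∧ (lookup F j) _) (cong (w j *_) (meets j)))))
    where
    meets : ∀ j → χ (any (lookup U) (C j)) ≡ 1ℚ - avoids U j
    meets j = trans (solve 1 (λ a → a := con 1ℚ :- (con 1ℚ :- a)) refl (χ (any (lookup U) (C j))))
      (cong (λ z → 1ℚ - z) (trans (sym (χ-not (any (lookup U) (C j)))) (cong χ (misses⇔⊆ᵇ-outside U (C j)))))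

  y-closed : ∀ U → y∅ Dc t U ≡ 1ℚ - c * gℚ U
  y-closed U = trans (y-normal-form t (g Dc U)) (cong (λ z → 1ℚ - c * z) (g-as-sum U))

  D-closed : ∀ S Q R → D (y∅ Dc t) S Q R ≡ isEmpty Q - c * sum (λ j → w j * (isEmpty Q - avoids (S ∪ R) j * within Q j))
  D-closed S Q R = begin
    sumL (λ T → sgn ∣ T ∣ * y∅ Dc t (S ∪ T ∪ R)) Ts
      ≡⟨ sumL-cong (λ T → cong (sgn ∣ T ∣ *_) (y-closed (S ∪ T ∪ R))) Ts ⟩
    sumL (λ T → sgn ∣ T ∣ * (1ℚ - c * gℚ (S ∪ T ∪ R))) Ts
      ≡⟨ sumL-affine c w (λ T → sgn ∣ T ∣) (λ j T → avoids (S ∪ T ∪ R) j) Ts ⟩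
    signs - c * sum (λ j → w j * (signs - IE-sum (X j) S Q R))
      ≡⟨ cong₂ (λ a b → a - c * b) signs≡ (sum-cong (λ j → cong₂ (λ a b → w j * (a - b)) signs≡ (inclusion-exclusion (X j) S Q R))) ⟩
    isEmpty Q - c * sum (λ j → w j * (isEmpty Q - avoids (S ∪ R) j * within Q j))
      ∎
    where
    open ≡-Reasoning
    Ts = filter (_⊆? Q) (subsets m)
    signs = sumL (λ T → sgn ∣ T ∣) Ts
    -- Σ_{T ⊆ Q} (-1)^{|T|} = [Q = ∅]: inclusion–exclusion with x = E
    signs≡ : signs ≡ isEmpty Q
    signs≡ = begin
      signs                 ≡⟨ sumL-cong (λ T → trans (sym (ℚP.*-identityʳ (sgn ∣ T ∣))) (cong (λ z → sgn ∣ T ∣ * χ z) (sym (⊆ᵇ-⊤ (S ∪ T ∪ R))))) Ts ⟩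
      IE-sum ⊤ S Q R        ≡⟨ inclusion-exclusion ⊤ S Q R ⟩
      χ (S ∪ R ⊆ᵇ ⊤) * isEmpty Q ≡⟨ cong (λ z → χ z * isEmpty Q) (⊆ᵇ-⊤ (S ∪ R)) ⟩
      1ℚ * isEmpty Q        ≡⟨ ℚP.*-identityˡ (isEmpty Q) ⟩
      isEmpty Q             ∎

-- Writing a(C_j) = Σ_{i ∈ C_j} a_i, the pairing of D with (a , b) is
--   c Σ_j w_j [S avoids C_j][Q ⊆ E(C_j)] (a(E ∖ E(C_j)) - b)         if Q ≠ ∅,
--   σ - c (σ g(S) + Σ_j w_j [S avoids C_j] a(C_j)),  σ = a(E) - b    if Q = ∅.
-- The first is nonnegative under the removal condition, the second is
-- the level condition.

module Reduction (G : Digraph) (Dc : GoodDecomposition G) (t : ℕ) where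
  open Digraph G
  open GoodDecomposition Dc
  open ClosedForm G Dc t

  inC outC : Fin N → Fin m → ℚ
  inC  j i = χ (i ∈ᵇ C j)
  outC j i = χ (not (i ∈ᵇ C j))

  onCycle offCycle : (Fin m → ℚ) → Fin N → ℚ
  onCycle  a j = sum (λ i → a i * inC j i)
  offCycle a j = sum (λ i → a i * outC j i)

  slack : (Fin m → ℚ) → ℚ → ℚ
  slack a b = sum a - b

  avoidedMass : (Fin m → ℚ) → Subset m → ℚ
  avoidedMass a S = sum (λ j → w j * avoids S j * onCycle a j)

  off≡all-on : ∀ a j → offCycle a j ≡ sum a - onCycle a j
  off≡all-on a j = begin
    sum (λ i → a i * outC j i)                   ≡⟨ sum-cong (λ i → trans (cong (a i *_) (χ-not (i ∈ᵇ C j)))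
                                                      (solve 2 (λ a x → a :* (con 1ℚ :- x) := con 1ℚ :* a :+ (:- con 1ℚ) :* (a :* x)) refl (a i) (inC j i))) ⟩
    sum (λ i → 1ℚ * a i + (- 1ℚ) * (a i * inC j i)) ≡⟨ sum-linear 1ℚ (- 1ℚ) a (λ i → a i * inC j i) ⟩
    1ℚ * sum a + (- 1ℚ) * onCycle a j            ≡⟨ solve 2 (λ A K → con 1ℚ :* A :+ (:- con 1ℚ) :* K := A :- K) refl (sum a) (onCycle a j) ⟩
    sum a - onCycle a j                          ∎
    where open ≡-Reasoning

  off-slack : ∀ a b j → offCycle a j - b ≡ slack a b - onCycle a j
  off-slack a b j = trans (cong (_- b) (off≡all-on a j))
    (solve 3 (λ A K b → (A :- K) :- b := (A :- b) :- K) refl (sum a) (onCycle a j) b)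

  D-∅ : ∀ S Q → D (y∅ Dc t) S Q ∅ ≡ isEmpty Q - c * sum (λ j → w j * (isEmpty Q - avoids S j * within Q j))
  D-∅ S Q = trans (D-closed S Q ∅) (cong (λ z → isEmpty Q - c * z) (sum-cong (λ j →
    cong (λ z → w j * (isEmpty Q - χ z * within Q j)) (∪∅-⊆ᵇ S (X j)))))

  D-⁅⁆ : ∀ S Q i → D (y∅ Dc t) S Q ⁅ i ⁆ ≡ isEmpty Q - c * sum (λ j → w j * (isEmpty Q - (avoids S j * outC j i) * within Q j))
  D-⁅⁆ S Q i = trans (D-closed S Q ⁅ i ⁆) (cong (λ z → isEmpty Q - c * z) (sum-cong (λ j →
    cong (λ z → w j * (isEmpty Q - z * within Q j))
      (trans (cong χ (∪⁅⁆-⊆ᵇ S (X j) i))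
        (trans (χ-∧ (S ⊆ᵇ X j) _) (cong (λ z → avoids S j * χ z) (lookup-outside (C j) i)))))))

  RemovalCondition : (Fin m → ℚ) → ℚ → Set
  RemovalCondition a b = ∀ j → j ∈ F → 0ℚ ≤ offCycle a j - b

  LevelCondition : (Fin m → ℚ) → ℚ → Set
  LevelCondition a b = ∀ S → ∣ S ∣ ℕ.≤ t → 0ℚ ≤ slack a b - c * (slack a b * gℚ S + avoidedMass a S)

  SA-value : (Fin m → ℚ) → ℚ → Subset m → Subset m → ℚ
  SA-value a b S Q = isEmpty Q * slack a b
    - c * sum (λ j → w j * (isEmpty Q * slack a b - avoids S j * within Q j * (offCycle a j - b)))

  SA-value-correct : ∀ a b S Q →
    sumℚ (map (λ i → a i * D (y∅ Dc t) S Q ⁅ i ⁆) (allFin m)) - b * D (y∅ Dc t) S Q ∅ ≡ SA-value a b S Q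
  SA-value-correct a b S Q = trans
    (cong₂ (λ u v → u - b * v)
      (trans (sum-allFin (λ i → a i * D (y∅ Dc t) S Q ⁅ i ⁆)) (sum-cong (λ i → cong (a i *_) (D-⁅⁆ S Q i))))
      (D-∅ S Q))
    (SA-pairing a b c (isEmpty Q) w (avoids S) (within Q) outC)

  -- Q ≠ ∅: every term of the cycle sum is nonnegative
  SA-value-nonempty : ∀ a b S Q → RemovalCondition a b →
    0ℚ ≤ 0ℚ * slack a b - c * sum (λ j → w j * (0ℚ * slack a b - avoids S j * within Q j * (offCycle a j - b)))
  SA-value-nonempty a b S Q removal = subst (0ℚ ≤_) (sym value) (0≤* (scale-nonneg t) (sum-nonneg Y Y≥0))
    where
    Y : Fin N → ℚ
    Y j = w j * (avoids S j * within Q j * (offCycle a j - b))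
    value : 0ℚ * slack a b - c * sum (λ j → w j * (0ℚ * slack a b - avoids S j * within Q j * (offCycle a j - b))) ≡ c * sum Y
    value = trans (cong (λ z → 0ℚ * slack a b - c * z)
      (trans (sum-cong (λ j → solve 4 (λ w s P X → w :* (con 0ℚ :* s :- P :* X) := (:- con 1ℚ) :* (w :* (P :* X)))
                                  refl (w j) (slack a b) (avoids S j * within Q j) (offCycle a j - b)))
             (sum-scale (- 1ℚ) Y)))
      (solve 3 (λ s c Y → con 0ℚ :* s :- c :* ((:- con 1ℚ) :* Y) := c :* Y) refl (slack a b) c (sum Y))
    Y≥0 : ∀ j → 0ℚ ≤ Y j
    Y≥0 j with lookup F j in j∈?F
    ... | true  = 0≤* (χ-nonneg true) (0≤* (0≤* (χ-nonneg (S ⊆ᵇ X j)) (χ-nonneg (Q #ᵇ X j))) (removal j (lookup⇒[]= j F j∈?F)))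
    ... | false = ℚP.≤-reflexive (sym (ℚP.*-zeroˡ (avoids S j * within Q j * (offCycle a j - b))))

  SA-value-empty : ∀ a b S Q → (∀ j → within Q j ≡ 1ℚ) →
    1ℚ * slack a b - c * sum (λ j → w j * (1ℚ * slack a b - avoids S j * within Q j * (offCycle a j - b)))
    ≡ slack a b - c * (slack a b * gℚ S + avoidedMass a S)
  SA-value-empty a b S Q within≡1 = cong₂ (λ u v → u - c * v) (ℚP.*-identityˡ (slack a b))
    (trans (sum-cong (λ j → trans (cong₂ (λ u v → w j * (1ℚ * slack a b - avoids S j * u * v)) (within≡1 j) (cong (_- b) (off≡all-on a j)))
       (solve 6 (λ w s P A K b → w :* (con 1ℚ :* (A :- b) :- P :* con 1ℚ :* ((A :- K) :- b))
                                 := (A :- b) :* (w :* (con 1ℚ :- P)) :+ con 1ℚ :* (w :* P :* K))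
              refl (w j) (slack a b) (avoids S j) (sum a) (onCycle a j) b)))
     (trans (sum-linear (slack a b) 1ℚ (λ j → w j * (1ℚ - avoids S j)) (λ j → w j * avoids S j * onCycle a j))
            (cong (λ z → slack a b * gℚ S + z) (ℚP.*-identityˡ (avoidedMass a S)))))

  reduce : ∀ a b → RemovalCondition a b → LevelCondition a b → SAIneq (y∅ Dc t) t a b
  reduce a b removal level S Q _ size =
    0≤-⇒≤ (subst (0ℚ ≤_) (sym (SA-value-correct a b S Q)) (by-emptiness (Q #ᵇ ⊤) refl))
    where
    by-emptiness : ∀ e → (Q #ᵇ ⊤) ≡ e →
      0ℚ ≤ χ e * slack a b - c * sum (λ j → w j * (χ e * slack a b - avoids S j * within Q j * (offCycle a j - b)))
    by-emptiness false _   = SA-value-nonempty a b S Q removal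
    by-emptiness true  Q≡∅ = subst (0ℚ ≤_) (sym (SA-value-empty a b S Q (λ j → cong χ (#ᵇ-⊤ Q (X j) Q≡∅))))
      (level S (ℕP.m+n≤o⇒m≤o ∣ S ∣ size))

module _ (G : Digraph) where
  open Digraph G

  enters : ∀ {A : Fin m → Set} (S : Subset n) {u v} → Reach G A u v → lookup S u ≡ false → lookup S v ≡ true →
    Σ (Fin m) λ e → A e × lookup S (head e) ≡ true × lookup S (tail e) ≡ false
  enters S here           u∉S v∈S = ⊥-elim (false≢true (trans (sym u∉S) v∈S))
  enters S (step e Ae walk) u∉S v∈S with lookup S (head e) in he
  ... | true  = e , Ae , he , u∉S
  ... | false = enters S walk he v∈S

  leaves : ∀ {A : Fin m → Set} (S : Subset n) {u v} → Reach G A u v → lookup S u ≡ true → lookup S v ≡ false →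
    Σ (Fin m) λ e → A e × lookup S (tail e) ≡ true × lookup S (head e) ≡ false
  leaves S here             u∈S v∉S = ⊥-elim (false≢true (trans (sym v∉S) u∈S))
  leaves S (step e Ae walk) u∈S v∉S with lookup S (head e) in he
  ... | false = e , Ae , u∈S , he
  ... | true  = leaves S walk he v∉S

lookup-∁ : ∀ {n} (S : Subset n) u → u ∈ ∁ S → lookup S u ≡ false
lookup-∁ S u u∈∁S = BoolP.not-injective (trans (sym (lookup-map u not S)) ([]=⇒lookup u∈∁S))

sum-over-list : ∀ {m} (f : Fin m → ℚ) L → Unique L → sum (λ i → f i * χ (i ∈ᵇ L)) ≡ sumℚ (map f L)
sum-over-list {m} f [] _ = trans (sum-cong (λ i → ℚP.*-zeroʳ (f i))) (sum-zero {m})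
sum-over-list f (e ∷ L) (e∉L ∷ uL) =
  trans (sum-cong split) (trans (∑-distrib-+ (λ i → χ (does (i ≟ e)) * f i) (λ i → f i * χ (i ∈ᵇ L))) (cong₂ _+_ (sum-δ f e) (sum-over-list f L uL)))
  where
  split : ∀ i → f i * χ (i ∈ᵇ (e ∷ L)) ≡ χ (does (i ≟ e)) * f i + f i * χ (i ∈ᵇ L)
  split i with i ≟ e
  ... | yes refl = trans (solve 1 (λ x → x :* con 1ℚ := con 1ℚ :* x :+ x :* con 0ℚ) refl (f i))
                         (cong (λ z → 1ℚ * f i + f i * χ z) (sym (∉⇒∈ᵇ (All¬⇒¬Any e∉L))))
  ... | no  _    = solve 2 (λ x y → x :* y := con 0ℚ :* x :+ x :* y) refl (f i) (χ (i ∈ᵇ L))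

module Decomposition (G : Digraph) (Dc : GoodDecomposition G) (t : ℕ) where
  open Digraph G
  open GoodDecomposition Dc
  open ClosedForm G Dc t
  open Reduction G Dc t

  telescope : (φ : Fin n → ℚ) → ∀ e es → Linked (λ f g → head f ≡ tail g) (e ∷ es) →
    sumℚ (map (λ x → φ (tail x) - φ (head x)) (e ∷ es)) ≡ φ (tail e) - φ (head (lastOf G e es))
  telescope φ e []       _         = ℚP.+-identityʳ _
  telescope φ e (f ∷ fs) (he≡tf ∷ linked) = begin
    (φ (tail e) - φ (head e)) + sumℚ (map (λ x → φ (tail x) - φ (head x)) (f ∷ fs))
      ≡⟨ cong (λ z → (φ (tail e) - φ (head e)) + z) (telescope φ f fs linked) ⟩
    (φ (tail e) - φ (head e)) + (φ (tail f) - φ end)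
      ≡⟨ cong (λ z → (φ (tail e) - φ (head e)) + (φ z - φ end)) (sym he≡tf) ⟩
    (φ (tail e) - φ (head e)) + (φ (head e) - φ end)
      ≡⟨ solve 3 (λ a b c → (a :- b) :+ (b :- c) := a :- c) refl (φ (tail e)) (φ (head e)) φend ⟩
    φ (tail e) - φ end
      ∎
    where
    open ≡-Reasoning
    end = head (lastOf G f fs)
    φend = φ end

  potential-on-cycle : (φ : Fin n → ℚ) (a : Fin m → ℚ) → (∀ e → a e ≡ φ (tail e) - φ (head e)) →
    ∀ j → onCycle a j ≡ 0ℚ
  potential-on-cycle φ a a≡dφ j = trans (sum-cong (λ i → cong (_* inC j i) (a≡dφ i))) (closed (C j) (dicycle j))
    where
    closed : ∀ L → IsDicycle G L → sum (λ i → (φ (tail i) - φ (head i)) * χ (i ∈ᵇ L)) ≡ 0ℚ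
    closed (e ∷ es) (linked , cyclic , distinct) = begin
      sum (λ i → (φ (tail i) - φ (head i)) * χ (i ∈ᵇ (e ∷ es)))
        ≡⟨ sum-over-list (λ i → φ (tail i) - φ (head i)) (e ∷ es) (UniqueP.map⁻ distinct) ⟩
      sumℚ (map (λ x → φ (tail x) - φ (head x)) (e ∷ es))
        ≡⟨ telescope φ e es linked ⟩
      φ (tail e) - φ (head (lastOf G e es))
        ≡⟨ cong (λ z → φ (tail e) - φ z) cyclic ⟩
      φ (tail e) - φ (tail e)
        ≡⟨ ℚP.+-inverseʳ (φ (tail e)) ⟩
      0ℚ
        ∎
      where open ≡-Reasoning

  one-cycle-per-edge : ∀ i → sum (λ j → inC j i) ≡ 1ℚ
  one-cycle-per-edge i with partition i
  ... | j₀ , i∈C₀ , unique = trans (sum-cong on-j₀) (sum-δ (λ _ → 1ℚ) j₀)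
    where
    on-j₀ : ∀ j → inC j i ≡ χ (does (j ≟ j₀)) * 1ℚ
    on-j₀ j with j ≟ j₀
    ... | yes refl = cong χ (∈⇒∈ᵇ i∈C₀)
    ... | no  j≢j₀ = cong χ (∉⇒∈ᵇ (λ i∈C → j≢j₀ (unique j i∈C)))

  sum-by-cycles : ∀ a → sum a ≡ sum (onCycle a)
  sum-by-cycles a = trans
    (sum-cong (λ i → trans (sym (ℚP.*-identityʳ (a i)))
      (trans (cong (a i *_) (sym (one-cycle-per-edge i))) (sym (sum-scale (a i) (λ j → inC j i))))))
    (∑-comm (λ i j → a i * inC j i))

  onCycle-nonneg : ∀ a → (∀ i → 0ℚ ≤ a i) → ∀ j → 0ℚ ≤ onCycle a j
  onCycle-nonneg a a≥0 j = sum-nonneg _ (λ i → 0≤* (a≥0 i) (χ-nonneg (i ∈ᵇ C j)))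

  avoidedMass≤ : ∀ a S → (∀ i → 0ℚ ≤ a i) → avoidedMass a S ≤ sum a
  avoidedMass≤ a S a≥0 = ℚP.≤-trans (sum-mono _ _ (λ j → weighted≤ j (onCycle-nonneg a a≥0 j)))
                                    (ℚP.≤-reflexive (sym (sum-by-cycles a)))
    where
    weighted≤ : ∀ j {x} → 0ℚ ≤ x → w j * avoids S j * x ≤ x
    weighted≤ j {x} x≥0 = 0≤-⇒≤ (subst (0ℚ ≤_) (solve 2 (λ y x → (con 1ℚ :- y) :* x := x :- y :* x) refl (w j * avoids S j) x)
      (0≤* (≤⇒0≤- (ℚP.≤-trans (ℚP.*-monoˡ-≤-nonNeg (w j) {{ℚ.nonNegative (χ-nonneg (lookup F j))}} (χ-≤1 (S ⊆ᵇ X j)))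
                              (ℚP.≤-trans (ℚP.≤-reflexive (ℚP.*-identityʳ (w j))) (χ-≤1 (lookup F j))))) x≥0))

  -- g(S) ≤ |S|: every counted cycle meets S, and the cycles are edge-disjoint
  g≤∣S∣ : ∀ S → gℚ S ≤ fromℕ ∣ S ∣
  g≤∣S∣ S = ℚP.≤-trans (sum-mono _ _ counted≤) (ℚP.≤-reflexive (begin
      sum (λ j → sum (λ i → χ (lookup S i) * inC j i))   ≡⟨ ∑-comm (λ j i → χ (lookup S i) * inC j i) ⟩
      sum (λ i → sum (λ j → χ (lookup S i) * inC j i))   ≡⟨ sum-cong (λ i → trans (sum-scale (χ (lookup S i)) (λ j → inC j i))
                                                             (trans (cong (χ (lookup S i) *_) (one-cycle-per-edge i)) (ℚP.*-identityʳ _))) ⟩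
      sum (λ i → χ (lookup S i))                         ≡⟨ sym (∣∣-as-sum S) ⟩
      fromℕ ∣ S ∣                                        ∎))
    where
    open ≡-Reasoning
    terms≥0 : ∀ j i → 0ℚ ≤ χ (lookup S i) * inC j i
    terms≥0 j i = 0≤* (χ-nonneg (lookup S i)) (χ-nonneg (i ∈ᵇ C j))
    counted≤ : ∀ j → w j * (1ℚ - avoids S j) ≤ sum (λ i → χ (lookup S i) * inC j i)
    counted≤ j with S ⊆ᵇ X j in S⊆X
    ... | true = ℚP.≤-trans (ℚP.≤-reflexive (ℚP.*-zeroʳ (w j))) (sum-nonneg _ (terms≥0 j))
    ... | false with ⊆ᵇ-witness S (X j) S⊆X
    ...   | i , i∈S , i∉X = ℚP.≤-trans (ℚP.≤-trans (ℚP.≤-reflexive (ℚP.*-identityʳ (w j))) (χ-≤1 (lookup F j)))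
        (ℚP.≤-trans (ℚP.≤-reflexive (sym (cong₂ (λ u v → χ u * χ v) i∈S i∈C)))
                    (term≤sum (λ i → χ (lookup S i) * inC j i) (terms≥0 j) i))
      where
      i∈C : (i ∈ᵇ C j) ≡ true
      i∈C = trans (sym (BoolP.not-involutive _)) (cong not (trans (sym (lookup-outside (C j) i)) i∉X))

module Families (G : Digraph) (Dc : GoodDecomposition G) (t : ℕ) where
  open Digraph G
  open GoodDecomposition Dc
  open ClosedForm G Dc t
  open Reduction G Dc t
  open Decomposition G Dc t

  -- zero slack: the level expression is c Σ_j w_j [S avoids C_j] (-a(C_j)),
  -- and -a(C_j) = a(E ∖ E(C_j)) - b ≥ 0 on F by the removal condition
  level-when-tight : ∀ a b → slack a b ≡ 0ℚ → RemovalCondition a b → LevelCondition a b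
  level-when-tight a b tight removal S _ = subst (0ℚ ≤_) (sym value) (0≤* (scale-nonneg t) (sum-nonneg Y Y≥0))
    where
    Y : Fin N → ℚ
    Y j = w j * avoids S j * (- onCycle a j)
    value : slack a b - c * (slack a b * gℚ S + avoidedMass a S) ≡ c * sum Y
    value = begin
      slack a b - c * (slack a b * gℚ S + avoidedMass a S)
        ≡⟨ cong (λ z → z - c * (z * gℚ S + avoidedMass a S)) tight ⟩
      0ℚ - c * (0ℚ * gℚ S + avoidedMass a S)
        ≡⟨ cong (λ z → 0ℚ - c * (0ℚ * gℚ S + z)) (trans (sum-cong (λ j →
             solve 3 (λ w P K → w :* P :* K := (:- con 1ℚ) :* (w :* P :* (:- K))) refl (w j) (avoids S j) (onCycle a j)))
             (sum-scale (- 1ℚ) Y)) ⟩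
      0ℚ - c * (0ℚ * gℚ S + (- 1ℚ) * sum Y)
        ≡⟨ solve 3 (λ c G Y → con 0ℚ :- c :* (con 0ℚ :* G :+ (:- con 1ℚ) :* Y) := c :* Y) refl c (gℚ S) (sum Y) ⟩
      c * sum Y
        ∎
      where open ≡-Reasoning
    Y≥0 : ∀ j → 0ℚ ≤ Y j
    Y≥0 j with lookup F j in j∈?F
    ... | true  = 0≤* (0≤* (χ-nonneg true) (χ-nonneg (S ⊆ᵇ X j)))
        (subst (0ℚ ≤_) (trans (off-slack a b j) (trans (cong (_- onCycle a j) tight) (ℚP.+-identityˡ (- onCycle a j))))
               (removal j (lookup⇒[]= j F j∈?F)))
    ... | false = ℚP.≤-reflexive (sym (trans (cong (_* (- onCycle a j)) (ℚP.*-zeroˡ (avoids S j))) (ℚP.*-zeroˡ (- onCycle a j))))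

  -- the arithmetic core of the level condition: with 1 = c (t + 2),
  -- s - c(s G + r) = c (s (t - G) + (2s - A) + (A - r))
  level-arithmetic : ∀ s G r A → 0ℚ ≤ s → G ≤ fromℕ t → r ≤ A → 0ℚ ≤ s + s - A → 0ℚ ≤ s - c * (s * G + r)
  level-arithmetic s G r A s≥0 G≤t r≤A 2s≥A = subst (0ℚ ≤_) (sym value)
      (0≤* (scale-nonneg t) (0≤+ (0≤+ (0≤* s≥0 (≤⇒0≤- G≤t)) 2s≥A) (≤⇒0≤- r≤A)))
    where
    value : s - c * (s * G + r) ≡ c * (s * (fromℕ t - G) + (s + s - A) + (A - r))
    value = trans (cong (λ z → z - c * (s * G + r)) (trans (sym (ℚP.*-identityʳ s)) (cong (s *_) (scale-inverse t))))
      (solve 6 (λ s c T G r A → s :* (c :* (con 1ℚ :+ (con 1ℚ :+ T))) :- c :* (s :* G :+ r)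
                                := c :* (s :* (T :- G) :+ (s :+ s :- A) :+ (A :- r)))
             refl s c (fromℕ t) G r A)

  -- for nonnegative a with 0 ≤ slack and a(E) ≤ 2·slack, using g(S) ≤ |S| ≤ t
  level-when-nonneg : ∀ a b → (∀ i → 0ℚ ≤ a i) → 0ℚ ≤ slack a b → 0ℚ ≤ slack a b + slack a b - sum a → LevelCondition a b
  level-when-nonneg a b a≥0 slack≥0 2slack≥a S size =
    level-arithmetic (slack a b) (gℚ S) (avoidedMass a S) (sum a) slack≥0
      (ℚP.≤-trans (g≤∣S∣ S) (fromℕ-mono size)) (avoidedMass≤ a S a≥0) 2slack≥a

  ind-nonneg : ∀ b → 0ℚ ≤ ind G b
  ind-nonneg b = subst (0ℚ ≤_) (sym (ind≡χ G b)) (χ-nonneg b)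

  pick : ∀ i₀ (f : Fin m → ℚ) → sum (λ i → ind G (does (i ≟ i₀)) * f i) ≡ f i₀
  pick i₀ f = trans (sum-cong (λ i → cong (_* f i) (ind≡χ G (does (i ≟ i₀))))) (sum-δ f i₀)

  nonneg-SA : ∀ i₀ → SAIneq (y∅ Dc t) t (λ e → ind G (does (e ≟ i₀))) 0ℚ
  nonneg-SA i₀ = reduce a 0ℚ removal (level-when-nonneg a 0ℚ (λ i → ind-nonneg (does (i ≟ i₀))) slack≥0 2slack≥a)
    where
    a : Fin m → ℚ
    a e = ind G (does (e ≟ i₀))
    total : sum a ≡ 1ℚ
    total = trans (sum-cong (λ i → sym (ℚP.*-identityʳ (a i)))) (pick i₀ (λ _ → 1ℚ))
    removal : RemovalCondition a 0ℚ
    removal j _ = subst (0ℚ ≤_) (sym (trans (cong (_- 0ℚ) (pick i₀ (outC j))) (ℚP.+-identityʳ (outC j i₀))))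
      (χ-nonneg (not (i₀ ∈ᵇ C j)))
    slack≥0 : 0ℚ ≤ slack a 0ℚ
    slack≥0 = subst (0ℚ ≤_) (sym (cong (_- 0ℚ) total)) (χ-nonneg true)
    2slack≥a : 0ℚ ≤ slack a 0ℚ + slack a 0ℚ - sum a
    2slack≥a = subst (0ℚ ≤_) (sym (cong (λ z → (z - 0ℚ) + (z - 0ℚ) - z) total)) (χ-nonneg true)

  -- -x_{i₀} ≥ -1: tight, and removal leaves [i₀ ∈ C_j] ≥ 0
  le-one-SA : ∀ i₀ → SAIneq (y∅ Dc t) t (λ e → - ind G (does (e ≟ i₀))) (- 1ℚ)
  le-one-SA i₀ = reduce a (- 1ℚ) removal (level-when-tight a (- 1ℚ) tight removal)
    where
    a : Fin m → ℚ
    a e = - ind G (does (e ≟ i₀))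
    pick⁻ : ∀ f → sum (λ i → a i * f i) ≡ - f i₀
    pick⁻ f = trans (sum-cong (λ i → solve 2 (λ x y → (:- x) :* y := (:- con 1ℚ) :* (x :* y)) refl (ind G (does (i ≟ i₀))) (f i)))
      (trans (sum-scale (- 1ℚ) (λ i → ind G (does (i ≟ i₀)) * f i))
        (trans (cong ((- 1ℚ) *_) (pick i₀ f)) (solve 1 (λ x → (:- con 1ℚ) :* x := :- x) refl (f i₀))))
    tight : slack a (- 1ℚ) ≡ 0ℚ
    tight = cong (_- (- 1ℚ)) (trans (sum-cong (λ i → sym (ℚP.*-identityʳ (a i)))) (pick⁻ (λ _ → 1ℚ)))
    removal : RemovalCondition a (- 1ℚ)
    removal j _ = subst (0ℚ ≤_)
      (sym (trans (cong (_- (- 1ℚ)) (trans (pick⁻ (outC j)) (cong -_ (χ-not (i₀ ∈ᵇ C j)))))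
                  (solve 1 (λ x → :- (con 1ℚ :- x) :- (:- con 1ℚ) := x) refl (inC j i₀))))
      (χ-nonneg (i₀ ∈ᵇ C j))

  -- flow conservation at a vertex: a is a potential difference, hence tight
  -- and zero on every cycle
  balance-SA : ∀ a (φ : Fin n → ℚ) → (∀ e → a e ≡ φ (tail e) - φ (head e)) → SAIneq (y∅ Dc t) t a 0ℚ
  balance-SA a φ a≡dφ = reduce a 0ℚ removal (level-when-tight a 0ℚ tight removal)
    where
    tight : slack a 0ℚ ≡ 0ℚ
    tight = cong (_- 0ℚ) (trans (sum-by-cycles a) (trans (sum-cong (potential-on-cycle φ a a≡dφ)) (sum-zero {N})))
    removal : RemovalCondition a 0ℚ
    removal j _ = subst (0ℚ ≤_) (sym (trans (off-slack a 0ℚ j) (cong₂ _-_ tight (potential-on-cycle φ a a≡dφ j)))) ℚP.≤-refl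

  crossing-edge : ∀ (β : Fin m → Bool) j e → ¬ e ∈ₗ C j → β e ≡ true → 0ℚ ≤ offCycle (λ e → ind G (β e)) j - 1ℚ
  crossing-edge β j e e∉C βe = ≤⇒0≤- (ℚP.≤-trans (ℚP.≤-reflexive (sym term≡1))
     (term≤sum (λ i → ind G (β i) * outC j i) (λ i → 0≤* (ind-nonneg (β i)) (χ-nonneg (not (i ∈ᵇ C j)))) e))
    where
    term≡1 : ind G (β e) * outC j e ≡ 1ℚ
    term≡1 = cong₂ (λ u v → ind G u * χ (not v)) βe (∉⇒∈ᵇ e∉C)

  -- level condition for a cut inequality x(δ(S)) ≥ 1, by the integer k = x(E) of
  -- cut edges: k = 0 contradicts the removal condition, k = 1 is tight, and
  -- k ≥ 2 leaves slack k - 1 ≥ k/2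
  cut-level : ∀ (β : Fin m → Bool) → RemovalCondition (λ e → ind G (β e)) 1ℚ →
    ∀ k → sum (λ e → ind G (β e)) ≡ fromℕ k → LevelCondition (λ e → ind G (β e)) 1ℚ
  cut-level β removal zero total≡0 with F-nonempty
  ... | j₀ , j₀∈F = ⊥-elim (0≰-1 (subst (0ℚ ≤_) value (0≤+ (removal j₀ j₀∈F) (onCycle-nonneg a (λ i → ind-nonneg (β i)) j₀))))
    where
    a : Fin m → ℚ
    a e = ind G (β e)
    0≰-1 : ¬ (0ℚ ≤ - 1ℚ)
    0≰-1 (ℚ.*≤* ())
    value : offCycle a j₀ - 1ℚ + onCycle a j₀ ≡ - 1ℚ
    value = trans (cong (_+ onCycle a j₀) (off-slack a 1ℚ j₀)) (trans (cong (λ z → z - 1ℚ - onCycle a j₀ + onCycle a j₀) total≡0)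
      (solve 1 (λ K → con 0ℚ :- con 1ℚ :- K :+ K := :- con 1ℚ) refl (onCycle a j₀)))
  cut-level β removal (suc zero) total≡1 = level-when-tight (λ e → ind G (β e)) 1ℚ (cong (_- 1ℚ) total≡1) removal
  cut-level β removal (suc (suc k)) total≡k+2 = level-when-nonneg a 1ℚ (λ i → ind-nonneg (β i))
      (subst (0ℚ ≤_) (sym slack≡) (0≤+ (χ-nonneg true) (fromℕ-nonneg k)))
      (subst (0ℚ ≤_) (sym excess≡) (fromℕ-nonneg k))
    where
    a : Fin m → ℚ
    a e = ind G (β e)
    total≡ : sum a ≡ 1ℚ + (1ℚ + fromℕ k)
    total≡ = trans total≡k+2 (trans (fromℕ-suc (suc k)) (cong (λ z → 1ℚ + z) (fromℕ-suc k)))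
    slack≡ : slack a 1ℚ ≡ 1ℚ + fromℕ k
    slack≡ = trans (cong (_- 1ℚ) total≡) (solve 1 (λ T → con 1ℚ :+ (con 1ℚ :+ T) :- con 1ℚ := con 1ℚ :+ T) refl (fromℕ k))
    excess≡ : slack a 1ℚ + slack a 1ℚ - sum a ≡ fromℕ k
    excess≡ = trans (cong (λ z → z - 1ℚ + (z - 1ℚ) - z) total≡)
      (solve 1 (λ T → (con 1ℚ :+ (con 1ℚ :+ T)) :- con 1ℚ :+ ((con 1ℚ :+ (con 1ℚ :+ T)) :- con 1ℚ) :- (con 1ℚ :+ (con 1ℚ :+ T)) := T) refl (fromℕ k))

  -- a cut inequality: the removal condition is where the good decomposition
  -- enters (supplied by the caller), the level condition uses integrality
  cut-SA : ∀ (β : Fin m → Bool) → RemovalCondition (λ e → ind G (β e)) 1ℚ → SAIneq (y∅ Dc t) t (λ e → ind G (β e)) 1ℚ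
  cut-SA β removal with sum-χ-integral β
  ... | k , total≡k = reduce (λ e → ind G (β e)) 1ℚ removal
                        (cut-level β removal k (trans (sum-cong (λ i → ind≡χ G (β i))) total≡k))

  -- every inequality of the balanced polytope; for the cut inequalities the
  -- removal condition comes from a crossing edge of the strongly connected
  -- G - E(C_j), for the balance equations from a vertex potential
  balanced-SA : ∀ {a b} → BalancedIneq G a b → SAIneq (y∅ Dc t) t a b
  balanced-SA (cut-in S (v , v∈S) (u , u∈∁S)) = cut-SA (λ e → lookup S (head e) ∧ not (lookup S (tail e))) removal
    where
    removal : RemovalCondition (λ e → ind G (lookup S (head e) ∧ not (lookup S (tail e)))) 1ℚ
    removal j j∈F with enters G S (F-good j j∈F u v) (lookup-∁ S u u∈∁S) ([]=⇒lookup v∈S)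
    ... | e , e∉C , he , te = crossing-edge (λ e → lookup S (head e) ∧ not (lookup S (tail e))) j e e∉C (cong₂ (λ x y → x ∧ not y) he te)
  balanced-SA (cut-out S (v , v∈S) (u , u∈∁S)) = cut-SA (λ e → lookup S (tail e) ∧ not (lookup S (head e))) removal
    where
    removal : RemovalCondition (λ e → ind G (lookup S (tail e) ∧ not (lookup S (head e)))) 1ℚ
    removal j j∈F with leaves G S (F-good j j∈F v u) ([]=⇒lookup v∈S) (lookup-∁ S u u∈∁S)
    ... | e , e∉C , te , he = crossing-edge (λ e → lookup S (tail e) ∧ not (lookup S (head e))) j e e∉C (cong₂ (λ x y → x ∧ not y) te he)
  balanced-SA (bal-≥ v) = balance-SA (λ e → outCut G ⁅ v ⁆ e - inCut G ⁅ v ⁆ e) (λ u → χ (lookup ⁅ v ⁆ u)) (λ e → out-in (lookup ⁅ v ⁆ (tail e)) (lookup ⁅ v ⁆ (head e)))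
    where
    out-in : ∀ x y → ind G (x ∧ not y) - ind G (y ∧ not x) ≡ χ x - χ y
    out-in true  true  = refl
    out-in true  false = refl
    out-in false true  = refl
    out-in false false = refl
  balanced-SA (bal-≤ v) = balance-SA (λ e → inCut G ⁅ v ⁆ e - outCut G ⁅ v ⁆ e) (λ u → - χ (lookup ⁅ v ⁆ u)) (λ e → in-out (lookup ⁅ v ⁆ (tail e)) (lookup ⁅ v ⁆ (head e)))
    where
    in-out : ∀ x y → ind G (y ∧ not x) - ind G (x ∧ not y) ≡ (- χ x) - (- χ y)
    in-out true  true  = refl
    in-out true  false = refl
    in-out false true  = refl
    in-out false false = refl
  balanced-SA (nonneg i) = nonneg-SA i
  balanced-SA (le-one i) = le-one-SA i

module Singletons (G : Digraph) (Dc : GoodDecomposition G) (t : ℕ) where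
  open Digraph G
  open GoodDecomposition Dc
  open ClosedForm G Dc t

  g-singleton : ∀ j e → e ∈ₗ C j → fromℕ (g Dc ⁅ e ⁆) ≡ w j
  g-singleton j e e∈Cj with partition e
  ... | _ , _ , unique = trans (∣∣-as-sum (tabulate (λ j′ → lookup F j′ ∧ any (lookup ⁅ e ⁆) (C j′))))
     (trans (sum-cong (λ j′ → trans (cong χ (trans (lookup∘tabulate _ j′) (cong (lookup F j′ ∧_) (∈ᵇ-⁅⁆ e (C j′))))) (only-j j′)))
            (sum-δ w j))
    where
    only-j : ∀ j′ → χ (lookup F j′ ∧ (e ∈ᵇ C j′)) ≡ χ (does (j′ ≟ j)) * w j′
    only-j j′ with j′ ≟ j
    ... | yes refl = trans (cong (λ z → χ (lookup F j ∧ z)) (∈⇒∈ᵇ e∈Cj))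
                           (trans (cong χ (BoolP.∧-identityʳ (lookup F j))) (sym (ℚP.*-identityˡ (w j))))
    ... | no  j′≢j = trans (cong (λ z → χ (lookup F j′ ∧ z)) (∉⇒∈ᵇ (λ e∈Cj′ → j′≢j (trans (unique j′ e∈Cj′) (sym (unique j e∈Cj))))))
                           (trans (cong χ (BoolP.∧-zeroʳ (lookup F j′))) (sym (ℚP.*-zeroˡ (w j′))))

  singleton-values : ∀ j e → e ∈ₗ C j →
    (j ∈ F → y∅ Dc t ⁅ e ⁆ ≡ (+ suc t) / suc (suc t)) × (j ∉ F → y∅ Dc t ⁅ e ⁆ ≡ 1ℚ)
  singleton-values j e e∈Cj = in-F , not-in-F
    where
    y-e : y∅ Dc t ⁅ e ⁆ ≡ 1ℚ - c * w j
    y-e = trans (y-normal-form t (g Dc ⁅ e ⁆)) (cong (λ z → 1ℚ - c * z) (g-singleton j e e∈Cj))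
    in-F : j ∈ F → y∅ Dc t ⁅ e ⁆ ≡ (+ suc t) / suc (suc t)
    in-F j∈F = trans y-e (trans (cong (λ z → 1ℚ - c * χ z) ([]=⇒lookup j∈F)) (sym (y-normal-form t 1)))
    not-in-F : j ∉ F → y∅ Dc t ⁅ e ⁆ ≡ 1ℚ
    not-in-F j∉F = trans y-e (trans (cong (λ z → 1ℚ - c * χ z) j∉?F) (solve 1 (λ c → con 1ℚ :- c :* con 0ℚ := con 1ℚ) refl c))
      where
      j∉?F : lookup F j ≡ false
      j∉?F with lookup F j in j∈?F
      ... | false = refl
      ... | true  = ⊥-elim (j∉F (lookup⇒[]= j F j∈?F))

corollary1 : (G : Digraph) → StronglyConnected G → (Dc : GoodDecomposition G) →
    (t : ℕ) →
      InSA (y∅ Dc t) t (BalancedIneq G)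
      × (∀ j e → e ∈ₗ GoodDecomposition.C Dc j →
           (j ∈ GoodDecomposition.F Dc → y∅ Dc t ⁅ e ⁆ ≡ (+ suc t) / suc (suc t))
           × (j ∉ GoodDecomposition.F Dc → y∅ Dc t ⁅ e ⁆ ≡ 1ℚ))
corollary1 G _ Dc t = (λ _ _ → Families.balanced-SA G Dc t) , Singletons.singleton-values G Dc t
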